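{- Let $k \ge 4$ and let $G$ be an $SQSR(n, k, 0; k-1, k-2, k-3)$ graph. Then $n - k - 1 \geq k+2$, i.e. $n \geq 2k+3$.
   Context: All graphs are finite and simple. A $QSR(n,k,a;c_1,\ldots,c_p)$ graph is a $k$-regular graph on $n$ vertices such that any two adjacent vertices have exactly $a$ common neighbours and any two distinct non-adjacent vertices have exactly $c_i$ common neighbours for some $1 \le i \le p$. Its grade is the number of indices $i$ for which there actually exist two non-adjacent vertices with exactly $c_i$ common neighbours; it is proper if its grade is $p$. An $SQSR(n,k,a;c_1,\ldots,c_p)$ graph is a proper $QSR(n,k,a;c_1,\ldots,c_p)$ graph in which $a, c_1, \ldots, c_p$ are pairwise distinct. -}

module Defs where

open import Data.Nat using (ℕ)
open import Data.Bool using (Bool; true; false; _∧_)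
open import Data.Fin using (Fin)
open import Data.List using (List; _∷_; filter; length; allFin)
open import Data.List.Membership.Propositional using (_∈_)
open import Data.List.Relation.Unary.All using (All)
open import Data.List.Relation.Unary.Unique.Propositional using (Unique)
open import Data.Product using (Σ; _×_; ∃₂)
open import Relation.Binary.PropositionalEquality using (_≡_; _≢_)
open import Relation.Nullary using (¬_)
open import Relation.Nullary.Decidable using (Dec)
open import Data.Bool.Properties using (T?)
open import Data.Bool using (T)

record Graph (n : ℕ) : Set where
  field
    adj   : Fin n → Fin n → Bool
    sym   : ∀ u v → adj u v ≡ adj v u
    irrefl : ∀ v → adj v v ≡ false

open Graph public

count : ∀ {n} → (Fin n → Bool) → ℕ
count {n} p = length (filter (λ x → T? (p x)) (allFin n))

Adjacent : ∀ {n} → Graph n → Fin n → Fin n → Set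
Adjacent G u v = T (adj G u v)

degree : ∀ {n} → Graph n → Fin n → ℕ
degree G v = count (adj G v)

commonNbrs : ∀ {n} → Graph n → Fin n → Fin n → ℕ
commonNbrs G u v = count (λ x → adj G u x ∧ adj G v x)

IsQSR : (n k a : ℕ) (cs : List ℕ) → Graph n → Set
IsQSR n k a cs G =
  (∀ v → degree G v ≡ k) ×
  (∀ u v → Adjacent G u v → commonNbrs G u v ≡ a) ×
  (∀ u v → u ≢ v → ¬ Adjacent G u v → commonNbrs G u v ∈ cs)

Proper : ∀ {n} (cs : List ℕ) → Graph n → Set
Proper {n} cs G =
  All (λ c → ∃₂ λ (u v : Fin n) → u ≢ v × ¬ Adjacent G u v × commonNbrs G u v ≡ c) cs

IsSQSR : (n k a : ℕ) (cs : List ℕ) → Graph n → Set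
IsSQSR n k a cs G = IsQSR n k a cs G × Proper cs G × Unique (a ∷ cs)

{-# OPTIONS --safe #-}
module Submission where

-- Properness gives vertices u, w with c = k − 3 ≥ 1 common neighbours; let v be
-- one of them. Since adjacent vertices have no common neighbours, N(u) and N(v)
-- are disjoint, and the k − c = 3 neighbours of w outside N(u) also lie outside
-- N(v) (as v ~ w). This exhibits 2k + 3 distinct vertices.

open import Defs hiding (sym)
open import Data.Nat using (ℕ; suc; _≤_; _+_; _*_; _∸_; z≤n; s≤s)
open import Data.Nat.Properties
  using (+-suc; +-identityʳ; m≤n⇒m≤1+n; n≤0⇒n≡0; m+n∸m≡n; m∸[m∸n]≡n; m<n⇒0<n∸m; <⇒≤; module ≤-Reasoning)
open import Data.List using (List; []; _∷_; filter; length; allFin)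
open import Data.List.Properties using (length-filter; length-tabulate)
open import Data.List.Relation.Unary.All using (_∷_; [])
open import Data.Bool using (Bool; true; false; _∧_; _∨_; not; T)
open import Data.Bool.Properties using (T?; T-∧)
open import Data.Unit using (tt)
open import Data.Product using (_×_; _,_; ∃; proj₁; proj₂)
open import Function.Bundles using (Equivalence)
open import Data.Fin using (Fin)
open import Relation.Binary.PropositionalEquality

module _ {A : Set} where

  countIn : (A → Bool) → List A → ℕ
  countIn p xs = length (filter (λ x → T? (p x)) xs)

  countIn-≤-length : ∀ (p : A → Bool) xs → countIn p xs ≤ length xs
  countIn-≤-length p = length-filter (λ x → T? (p x))

  countIn-split : ∀ (p q : A → Bool) xs →
    countIn q xs ≡ countIn (λ x → p x ∧ q x) xs + countIn (λ x → not (p x) ∧ q x) xs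
  countIn-split p q [] = refl
  countIn-split p q (x ∷ xs) with p x | q x
  ... | true  | true  = cong suc (countIn-split p q xs)
  ... | true  | false = countIn-split p q xs
  ... | false | true  = trans (cong suc (countIn-split p q xs)) (sym (+-suc _ _))
  ... | false | false = countIn-split p q xs

  countIn-∨-+-∧ : ∀ (p q : A → Bool) xs →
    countIn (λ x → p x ∨ q x) xs + countIn (λ x → p x ∧ q x) xs ≡ countIn p xs + countIn q xs
  countIn-∨-+-∧ p q [] = refl
  countIn-∨-+-∧ p q (x ∷ xs) with p x | q x
  ... | true  | true  = cong suc (trans (+-suc _ _)
                          (trans (cong suc (countIn-∨-+-∧ p q xs)) (sym (+-suc _ _))))
  ... | true  | false = cong suc (countIn-∨-+-∧ p q xs)
  ... | false | true  = trans (cong suc (countIn-∨-+-∧ p q xs)) (sym (+-suc _ _))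
  ... | false | false = countIn-∨-+-∧ p q xs

  countIn-∨-disjoint : ∀ (p q : A → Bool) xs → countIn (λ x → p x ∧ q x) xs ≡ 0 →
    countIn (λ x → p x ∨ q x) xs ≡ countIn p xs + countIn q xs
  countIn-∨-disjoint p q xs p∧q≡0 = begin
    countIn (λ x → p x ∨ q x) xs                                ≡⟨ sym (+-identityʳ _) ⟩
    countIn (λ x → p x ∨ q x) xs + 0                            ≡⟨ cong (countIn (λ x → p x ∨ q x) xs +_) (sym p∧q≡0) ⟩
    countIn (λ x → p x ∨ q x) xs + countIn (λ x → p x ∧ q x) xs ≡⟨ countIn-∨-+-∧ p q xs ⟩
    countIn p xs + countIn q xs                                 ∎
    where open ≡-Reasoning

  countIn-mono : ∀ (p q : A → Bool) xs → (∀ x → T (p x) → T (q x)) → countIn p xs ≤ countIn q xs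
  countIn-mono p q [] p⇒q = z≤n
  countIn-mono p q (x ∷ xs) p⇒q with p x | q x | p⇒q x
  ... | true  | true  | _ = s≤s (countIn-mono p q xs p⇒q)
  ... | true  | false | qx with () ← qx tt
  ... | false | true  | _ = m≤n⇒m≤1+n (countIn-mono p q xs p⇒q)
  ... | false | false | _ = countIn-mono p q xs p⇒q

  countIn-pos⇒∃ : ∀ (p : A → Bool) xs → 1 ≤ countIn p xs → ∃ λ x → T (p x)
  countIn-pos⇒∃ p (x ∷ xs) pos with p x in px
  ... | true  = x , subst T (sym px) tt
  ... | false = countIn-pos⇒∃ p xs pos

count-≤-order : ∀ {n} (p : Fin n → Bool) → count p ≤ n
count-≤-order {n} p = subst (count p ≤_) (length-tabulate (λ i → i)) (countIn-≤-length p (allFin n))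

module _ {n k : ℕ} (G : Graph n)
         (regular : ∀ v → degree G v ≡ k)
         (triangleFree : ∀ u v → Adjacent G u v → commonNbrs G u v ≡ 0) where

  count-N∖N≡k∸commonNbrs : ∀ u w → count (λ x → not (adj G u x) ∧ adj G w x) ≡ k ∸ commonNbrs G u w
  count-N∖N≡k∸commonNbrs u w = begin
    count N∖N                               ≡⟨ sym (m+n∸m≡n c _) ⟩
    c + count N∖N ∸ c                       ≡⟨ cong (_∸ c) (sym (countIn-split (adj G u) (adj G w) (allFin n))) ⟩
    degree G w ∸ c                          ≡⟨ cong (_∸ c) (regular w) ⟩
    k ∸ c                                   ∎
    where
    open ≡-Reasoning
    c : ℕ
    c = commonNbrs G u w
    N∖N : Fin n → Bool
    N∖N x = not (adj G u x) ∧ adj G w x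

  2*k+[k∸commonNbrs]≤order : ∀ u w → 1 ≤ commonNbrs G u w → 2 * k + (k ∸ commonNbrs G u w) ≤ n
  2*k+[k∸commonNbrs]≤order u w common = begin
    2 * k + (k ∸ c)                        ≡⟨ cong₂ _+_ (cong (k +_) (+-identityʳ k)) (sym (count-N∖N≡k∸commonNbrs u w)) ⟩
    k + k + count Nw∖Nu                    ≡⟨ cong (_+ count Nw∖Nu) (sym (cong₂ _+_ (regular u) (regular v))) ⟩
    count Nu + count Nv + count Nw∖Nu      ≡⟨ cong (_+ count Nw∖Nu) (sym (countIn-∨-disjoint Nu Nv xs Nu∩Nv≡0)) ⟩
    count Nu∪Nv + count Nw∖Nu              ≡⟨ sym (countIn-∨-disjoint Nu∪Nv Nw∖Nu xs Nu∪Nv∩Nw∖Nu≡0) ⟩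
    count (λ x → Nu∪Nv x ∨ Nw∖Nu x)       ≤⟨ count-≤-order _ ⟩
    n                                      ∎
    where
    open ≤-Reasoning
    xs : List (Fin n)
    xs = allFin n

    c : ℕ
    c = commonNbrs G u w

    Nu Nw : Fin n → Bool
    Nu = adj G u
    Nw = adj G w

    v∈Nu∩Nw : ∃ λ v → T (Nu v ∧ Nw v)
    v∈Nu∩Nw = countIn-pos⇒∃ (λ x → Nu x ∧ Nw x) xs common

    v : Fin n
    v = proj₁ v∈Nu∩Nw

    u~v×w~v : Adjacent G u v × Adjacent G w v
    u~v×w~v = Equivalence.to T-∧ (proj₂ v∈Nu∩Nw)

    Nv : Fin n → Bool
    Nv = adj G v

    Nu∪Nv Nw∖Nu : Fin n → Bool
    Nu∪Nv x = Nu x ∨ Nv x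
    Nw∖Nu x = not (Nu x) ∧ Nw x

    Nu∩Nv≡0 : count (λ x → Nu x ∧ Nv x) ≡ 0
    Nu∩Nv≡0 = triangleFree u v (proj₁ u~v×w~v)

    Nv∩Nw≡0 : count (λ x → Nv x ∧ Nw x) ≡ 0
    Nv∩Nw≡0 = triangleFree v w (subst T (Graph.sym G w v) (proj₂ u~v×w~v))

    Nu∪Nv∩Nw∖Nu⊆Nv∩Nw : ∀ x → T (Nu∪Nv x ∧ Nw∖Nu x) → T (Nv x ∧ Nw x)
    Nu∪Nv∩Nw∖Nu⊆Nv∩Nw x h with Nu x | Nv x | Nw x
    Nu∪Nv∩Nw∖Nu⊆Nv∩Nw x () | true | _ | _
    ... | false | true | true = tt

    Nu∪Nv∩Nw∖Nu≡0 : count (λ x → Nu∪Nv x ∧ Nw∖Nu x) ≡ 0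
    Nu∪Nv∩Nw∖Nu≡0 = n≤0⇒n≡0 (subst (count (λ x → Nu∪Nv x ∧ Nw∖Nu x) ≤_) Nv∩Nw≡0
      (countIn-mono (λ x → Nu∪Nv x ∧ Nw∖Nu x) (λ x → Nv x ∧ Nw x) xs Nu∪Nv∩Nw∖Nu⊆Nv∩Nw))

mainTheorem12 : (n k : ℕ) → 4 ≤ k → (G : Graph n) →
    IsSQSR n k 0 ((k ∸ 1) ∷ (k ∸ 2) ∷ (k ∸ 3) ∷ []) G →
    2 * k + 3 ≤ n
mainTheorem12 n k 4≤k G ((regular , triangleFree , _) , (_ ∷ _ ∷ (u , w , _ , _ , c≡k∸3) ∷ []) , _) =
  subst (λ e → 2 * k + e ≤ n) k∸c≡3
    (2*k+[k∸commonNbrs]≤order G regular triangleFree u w (subst (1 ≤_) (sym c≡k∸3) (m<n⇒0<n∸m 4≤k)))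
  where
  k∸c≡3 : k ∸ commonNbrs G u w ≡ 3
  k∸c≡3 = trans (cong (k ∸_) c≡k∸3) (m∸[m∸n]≡n (<⇒≤ 4≤k))
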